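{- Let $\mathcal{C}$ be a profile class and let $(p,I),(q,J)$ be distinct elements of $\mathrm{pr}(\mathcal{C})$ with $I=[a,b]$, $J=[c,d]$, $p\ge q$ and $c<b$. Then $$\sum_{P\in\mathcal{C}}(-1)^{|P|}=0.$$
   Context: A partition is a weakly decreasing sequence $\sigma=(\sigma_1,\sigma_2,\ldots)$ of nonnegative integers with finitely many positive terms, with the convention $\sigma_\infty=0$, indices in $[1,\infty]$. The $p$-interval of $\sigma$ ($p\ge0$) is $\{i\in[1,\infty]:\sigma_i=p\}$ (an interval, possibly with right endpoint $\infty$). For a finite nonempty set $P$ of partitions, $\mathrm{pr}_p(P)=\{(p,I):I$ is an inclusion-maximal element of the set of nonempty $p$-intervals of members of $P\}$, and the profile is $\mathrm{pr}(P)=\bigcup_{p\ge0}\mathrm{pr}_p(P)$. A profile class is an equivalence class of nonempty finite sets of partitions under the relation of having the same profile; $\mathrm{pr}(\mathcal{C})$ denotes the common profile of its members. -}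

module Defs where

open import Data.Nat using (ℕ; zero; suc; _≤_; _<_)
open import Data.Integer using (ℤ; -1ℤ; _^_) renaming (_+_ to _+ℤ_; 0ℤ to 0ℤ)
open import Data.List using (List; []; _∷_; length)
open import Data.List.Membership.Propositional using (_∈_)
open import Data.List.Relation.Unary.All using (All)
open import Data.List.Relation.Unary.Any using (Any)
open import Data.List.Relation.Unary.AllPairs using (AllPairs)
open import Data.List.Relation.Unary.Linked using (Linked)
open import Data.Product using (_×_; Σ; ∃; ∃-syntax; _,_)
open import Function.Bundles using (_⇔_)
open import Relation.Binary.PropositionalEquality using (_≡_; _≢_)
open import Relation.Nullary using (¬_)

-- Partitions: the list of positive parts (σ₁, σ₂, …), weakly decreasing.
-- All further terms (and σ_∞) are 0.

Partition : Set
Partition = List ℕ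

IsPartition : Partition → Set
IsPartition σ = All (λ x → 1 ≤ x) σ × Linked (λ x y → y ≤ x) σ

-- Indices in ℕ ∪ {∞}; only indices ≥ 1 are meaningful.

data Ext : Set where
  fin : ℕ → Ext
  ∞   : Ext

data _≤ᵉ_ : Ext → Ext → Set where
  fin≤fin : ∀ {m n} → m ≤ n → fin m ≤ᵉ fin n
  x≤∞     : ∀ {x} → x ≤ᵉ ∞

data _<ᵉ_ : Ext → Ext → Set where
  fin<fin : ∀ {m n} → m < n → fin m <ᵉ fin n
  fin<∞   : ∀ {m} → fin m <ᵉ ∞

Idx : Ext → Set
Idx i = fin 1 ≤ᵉ i

-- 0-based lookup with default 0
nth : Partition → ℕ → ℕ
nth []      _       = 0
nth (x ∷ σ) zero    = x
nth (x ∷ σ) (suc k) = nth σ k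

-- σ_i (1-based), with σ_∞ = 0
val : Partition → Ext → ℕ
val σ (fin zero)    = 0   -- not a valid index; never used
val σ (fin (suc k)) = nth σ k
val σ ∞             = 0

InInt : Ext → Ext → Ext → Set
InInt a b i = Idx i × a ≤ᵉ i × i ≤ᵉ b

_⊆ᴵ_ : Ext × Ext → Ext × Ext → Set
(a , b) ⊆ᴵ (a' , b') = ∀ i → InInt a b i → InInt a' b' i

-- "the p-interval of σ is the nonempty interval [a, b]"
-- (a ≥ 1 and a ≤ b make the endpoint representation unique)
IsPInterval : Partition → ℕ → Ext → Ext → Set
IsPInterval σ p a b =
  Idx a × a ≤ᵉ b × (∀ i → Idx i → (val σ i ≡ p ⇔ (a ≤ᵉ i × i ≤ᵉ b)))

IsFinSetPart : List Partition → Set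
IsFinSetPart P = All IsPartition P × AllPairs _≢_ P

NonEmpty : List Partition → Set
NonEmpty P = ∃[ σ ] σ ∈ P

SetEq : List Partition → List Partition → Set
SetEq P Q = ∀ σ → (σ ∈ P ⇔ σ ∈ Q)

-- (p , [a , b]) ∈ pr(P): [a,b] is an inclusion-maximal element of the set of
-- nonempty p-intervals of members of P.
InProfile : List Partition → ℕ → Ext → Ext → Set
InProfile P p a b =
  (∃[ σ ] (σ ∈ P × IsPInterval σ p a b)) ×
  (∀ σ' a' b' → σ' ∈ P → IsPInterval σ' p a' b' →
     (a , b) ⊆ᴵ (a' , b') → (a' , b') ⊆ᴵ (a , b))

SameProfile : List Partition → List Partition → Set
SameProfile P Q = ∀ p a b → (InProfile P p a b ⇔ InProfile Q p a b)

InClassOf : List Partition → List Partition → Set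
InClassOf P₀ Q = IsFinSetPart Q × NonEmpty Q × SameProfile Q P₀

EnumeratesClass : List Partition → List (List Partition) → Set
EnumeratesClass P₀ L =
  All (InClassOf P₀) L ×
  AllPairs (λ P Q → ¬ SetEq P Q) L ×
  (∀ Q → InClassOf P₀ Q → Any (SetEq Q) L)

signedSum : List (List Partition) → ℤ
signedSum []      = 0ℤ
signedSum (P ∷ L) = (-1ℤ ^ length P) +ℤ signedSum L

module Submission where

-- Proof by a sign-reversing involution.  The two profile elements yield
-- 0-based positions c₀ < k and thresholds r, p such that every Q ∈ 𝒞 has an
-- "upper" member (σ_{c₀} > r, σ_k ≥ p) and a "lower" one (ρ_{c₀} ≤ r, ρ_k < p).
-- Splicing the lexicographically least head σ₁…σ_{k+1} of an upper member with
-- the least tail ρ_{c₀+1}… of a lower one, at a cut chosen from Q, gives a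
-- canonical τ(Q).  Every interval of a splice lies in an interval of one of
-- its pieces, so toggling τ(Q) keeps the profile; and the toggle does not
-- change h, t or the cut, so Q ↦ Q △ {τ(Q)} is an involution of 𝒞 flipping
-- (-1)^{|Q|}.

open import Defs
open import Data.Nat using (ℕ; zero; suc; _+_; _∸_; _≤_; _<_; z≤n; s≤s; _≟_; _≤?_; _<?_)
open import Data.Nat.Properties
open import Data.Integer using (ℤ; +_; -[1+_]; 0ℤ; -1ℤ; -_) renaming (_+_ to _+ℤ_; _^_ to _^ℤ_)
import Data.Integer.Properties as ℤ
open import Data.Fin using (Fin) renaming (zero to fzero; suc to fsuc)
open import Data.Fin.Permutation using (Permutation; permutation)
open import Algebra.Properties.CommutativeMonoid.Sum ℤ.+-0-commutativeMonoid using (sum; sum-permute; sum-cong-≗)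
open import Data.List using (List; []; _∷_; length; take; drop; _++_; filter; lookup)
open import Data.List.Relation.Unary.All using (All; []; _∷_)
open import Data.List.Relation.Unary.All.Properties using (++⁺; take⁺; drop⁺)
import Data.List.Properties as List
open import Data.List.Membership.Propositional using (_∈_; _∉_)
open import Data.List.Membership.Propositional.Properties using (∈-filter⁺; ∈-filter⁻; ∈-lookup)
open import Data.List.Relation.Unary.Any using (Any; here; there)
open import Data.List.Relation.Unary.Any.Properties using (lookup-index)
open import Data.List.Relation.Unary.AllPairs using (AllPairs; []; _∷_)
import Data.List.Relation.Unary.All as All
import Data.List.Relation.Unary.Any as Any
import Data.List.Relation.Unary.All.Properties as All
import Data.List.Relation.Unary.AllPairs.Properties as AllPairs
open import Data.List.Relation.Binary.Lex.NonStrict using () renaming (≤-decTotalOrder to lex-decTotalOrder)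
open import Data.List.Relation.Binary.Pointwise using (Pointwise-≡⇒≡)
open import Relation.Binary.Bundles using (DecTotalOrder)
open import Data.List.Membership.DecPropositional (List.≡-dec _≟_) using (_∈?_)
open import Data.List.Relation.Unary.Linked using (Linked; []; [-]; _∷_)
open import Data.Product using (_×_; _,_; ∃-syntax; proj₁; proj₂) renaming (map to map×)
open import Data.Sum using (_⊎_; inj₁; inj₂; [_,_]′)
open import Data.Empty using (⊥; ⊥-elim)
open import Data.Unit using (⊤; tt)
open import Function.Bundles using (_⇔_; mk⇔; Equivalence)
open import Function.Properties.Equivalence using () renaming (sym to ⇔-sym; trans to ⇔-trans)
open import Relation.Binary.PropositionalEquality using (_≡_; _≢_; refl; sym; trans; cong; cong₂; subst; module ≡-Reasoning)
open import Relation.Nullary using (¬_; Dec; yes; no; ¬?)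
open import Relation.Nullary.Decidable using (decidable-stable; _×-dec_; map′)

Decreasing : List ℕ → Set
Decreasing = Linked (λ x y → y ≤ x)

Decreasing-tail : ∀ {x σ} → Decreasing (x ∷ σ) → Decreasing σ
Decreasing-tail [-] = []
Decreasing-tail (_ ∷ l) = l

nth-step : ∀ {σ} → Decreasing σ → ∀ i → nth σ (suc i) ≤ nth σ i
nth-step [] i = z≤n
nth-step [-] i = z≤n
nth-step (y≤x ∷ _) zero = y≤x
nth-step (_ ∷ l) (suc i) = nth-step l i

nth-mono : ∀ {σ} → Decreasing σ → ∀ {i j} → i ≤ j → nth σ j ≤ nth σ i
nth-mono {σ} l {i} i≤j with m≤n⇒∃[o]m+o≡n i≤j
... | k , refl = go k
  where
  go : ∀ k → nth σ (i + k) ≤ nth σ i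
  go zero rewrite +-identityʳ i = ≤-refl
  go (suc k) rewrite +-suc i k = ≤-trans (nth-step l (i + k)) (go k)

decreasing-from-steps : ∀ l → (∀ i → nth l (suc i) ≤ nth l i) → Decreasing l
decreasing-from-steps [] h = []
decreasing-from-steps (x ∷ []) h = [-]
decreasing-from-steps (x ∷ y ∷ l) h = h 0 ∷ decreasing-from-steps (y ∷ l) (λ i → h (suc i))

nth-length : ∀ σ j → 1 ≤ nth σ j → j < length σ
nth-length [] j ()
nth-length (x ∷ σ) zero h = s≤s z≤n
nth-length (x ∷ σ) (suc j) h = s≤s (nth-length σ j h)

nth-beyond : ∀ σ → nth σ (length σ) ≡ 0
nth-beyond [] = refl
nth-beyond (x ∷ σ) = nth-beyond σ

≤ᵉ-refl : ∀ {x} → x ≤ᵉ x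
≤ᵉ-refl {fin n} = fin≤fin ≤-refl
≤ᵉ-refl {∞} = x≤∞

≤ᵉ-trans : ∀ {x y z} → x ≤ᵉ y → y ≤ᵉ z → x ≤ᵉ z
≤ᵉ-trans (fin≤fin p) (fin≤fin q) = fin≤fin (≤-trans p q)
≤ᵉ-trans _ x≤∞ = x≤∞

≤ᵉ-antisym : ∀ {x y} → x ≤ᵉ y → y ≤ᵉ x → x ≡ y
≤ᵉ-antisym (fin≤fin p) (fin≤fin q) = cong fin (≤-antisym p q)
≤ᵉ-antisym x≤∞ x≤∞ = refl

<ᵉ⇒≤ᵉ : ∀ {x y} → x <ᵉ y → x ≤ᵉ y
<ᵉ⇒≤ᵉ (fin<fin m<n) = fin≤fin (<⇒≤ m<n)
<ᵉ⇒≤ᵉ fin<∞ = x≤∞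

<ᵉ⇒≱ᵉ : ∀ {x y} → x <ᵉ y → ¬ y ≤ᵉ x
<ᵉ⇒≱ᵉ (fin<fin m<n) (fin≤fin n≤m) = <⇒≱ m<n n≤m
<ᵉ⇒≱ᵉ fin<∞ ()

<ᵉ-or-≥ᵉ : ∀ x y → x <ᵉ y ⊎ y ≤ᵉ x
<ᵉ-or-≥ᵉ (fin m) (fin n) with m <? n
... | yes m<n = inj₁ (fin<fin m<n)
... | no m≮n = inj₂ (fin≤fin (≮⇒≥ m≮n))
<ᵉ-or-≥ᵉ (fin m) ∞ = inj₁ fin<∞
<ᵉ-or-≥ᵉ ∞ y = inj₂ x≤∞

<ᵉ⇒≢∞ : ∀ {x y} → x <ᵉ y → x ≢ ∞
<ᵉ⇒≢∞ () refl

¬Idx-0 : ¬ Idx (fin 0)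
¬Idx-0 (fin≤fin ())

⊆ᴵ-trans : ∀ {x y z : Ext × Ext} → x ⊆ᴵ y → y ⊆ᴵ z → x ⊆ᴵ z
⊆ᴵ-trans {_ , _} {_ , _} {_ , _} s t i h = t i (s i h)

⊆ᴵ-from-endpoints : ∀ {a b c d} → c ≤ᵉ a → b ≤ᵉ d → (a , b) ⊆ᴵ (c , d)
⊆ᴵ-from-endpoints ca bd i (ix , ai , ib) = ix , ≤ᵉ-trans ca ai , ≤ᵉ-trans ib bd

⊆ᴵ-antisym : ∀ {a b a' b'} → Idx a → a ≤ᵉ b → Idx a' → a' ≤ᵉ b' →
  (a , b) ⊆ᴵ (a' , b') → (a' , b') ⊆ᴵ (a , b) → a ≡ a' × b ≡ b'
⊆ᴵ-antisym ia ab ia' ab' s t =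
  ≤ᵉ-antisym (proj₁ (proj₂ (t _ (ia' , ≤ᵉ-refl , ab')))) (proj₁ (proj₂ (s _ (ia , ≤ᵉ-refl , ab)))) ,
  ≤ᵉ-antisym (proj₂ (proj₂ (s _ (≤ᵉ-trans ia ab , ab , ≤ᵉ-refl))))
             (proj₂ (proj₂ (t _ (≤ᵉ-trans ia' ab' , ab' , ≤ᵉ-refl))))

finite-position : ∀ {x} → Idx x → x ≢ ∞ → ∃[ j ] x ≡ fin (suc j)
finite-position {fin (suc j)} _ _ = j , refl
finite-position {fin zero} ix _ = ⊥-elim (¬Idx-0 ix)
finite-position {∞} _ x≢∞ = ⊥-elim (x≢∞ refl)

module PInterval {σ v a b} (I : IsPInterval σ v a b) where

  value-inside : ∀ i → InInt a b i → val σ i ≡ v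
  value-inside i (ix , ai , ib) = Equivalence.from (proj₂ (proj₂ I) i ix) (ai , ib)

  value-outside : ∀ {i} → Idx i → ¬ (a ≤ᵉ i × i ≤ᵉ b) → val σ i ≢ v
  value-outside ix n e = n (Equivalence.to (proj₂ (proj₂ I) _ ix) e)

  Idx-start : Idx a
  Idx-start = proj₁ I

  start≤end : a ≤ᵉ b
  start≤end = proj₁ (proj₂ I)

  Idx-end : Idx b
  Idx-end = ≤ᵉ-trans Idx-start start≤end

  value-start : val σ a ≡ v
  value-start = value-inside a (Idx-start , ≤ᵉ-refl , start≤end)

  value-end : val σ b ≡ v
  value-end = value-inside b (Idx-end , start≤end , ≤ᵉ-refl)

  end-∞ : b ≡ ∞ → v ≡ 0
  end-∞ refl = sym value-end

  -- … and it contains ∞, so a finite end means v ≥ 1.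
  end-fin : ∀ {n} → b ≡ fin n → 1 ≤ v
  end-fin refl = n≢0⇒n>0 λ v≡0 → ∞≰fin (Equivalence.to (proj₂ (proj₂ I) ∞ x≤∞) (sym v≡0))
    where
    ∞≰fin : ¬ (a ≤ᵉ ∞ × ∞ ≤ᵉ b)
    ∞≰fin (_ , ())

  -- The start is finite: past the end of σ the value is 0, so a = ∞ would put
  -- position length σ + 1 into [∞, b].
  start≢∞ : a ≢ ∞
  start≢∞ refl with value-start
  ... | refl with Equivalence.to (proj₂ (proj₂ I) (fin (suc (length σ))) (fin≤fin (s≤s z≤n))) (nth-beyond σ)
  ...   | () , _

  start-fin : ∃[ j ] a ≡ fin (suc j)
  start-fin = finite-position Idx-start start≢∞

-- The number of leading entries of σ that are ≥ v; in a decreasing list these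
-- are exactly the entries ≥ v, which locates every value-interval.
countAtLeast : ℕ → List ℕ → ℕ
countAtLeast v [] = 0
countAtLeast v (x ∷ σ) with v ≤? x
... | yes _ = suc (countAtLeast v σ)
... | no _ = 0

nth≤head : ∀ {x σ} → Decreasing (x ∷ σ) → ∀ j → nth (x ∷ σ) j ≤ x
nth≤head l j = nth-mono l {0} {j} z≤n

<countAtLeast : ∀ {σ} → Decreasing σ → ∀ v → 1 ≤ v → ∀ j → v ≤ nth σ j → j < countAtLeast v σ
<countAtLeast {[]} l v 1≤v j h = ⊥-elim (<⇒≱ 1≤v h)
<countAtLeast {x ∷ σ} l v 1≤v j h with v ≤? x
<countAtLeast {x ∷ σ} l v 1≤v zero h | yes _ = s≤s z≤n
<countAtLeast {x ∷ σ} l v 1≤v (suc j) h | yes _ = s≤s (<countAtLeast (Decreasing-tail l) v 1≤v j h)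
... | no v≰x = ⊥-elim (v≰x (≤-trans h (nth≤head l j)))

countAtLeast-sound : ∀ {σ} → Decreasing σ → ∀ v j → j < countAtLeast v σ → v ≤ nth σ j
countAtLeast-sound {x ∷ σ} l v j h with v ≤? x
countAtLeast-sound {x ∷ σ} l v zero h | yes v≤x = v≤x
countAtLeast-sound {x ∷ σ} l v (suc j) (s≤s h) | yes _ = countAtLeast-sound (Decreasing-tail l) v j h

positive-positions : ∀ {σ} → Decreasing σ → ∀ v k → 1 ≤ v →
  nth σ k ≡ v ⇔ (countAtLeast (suc v) σ ≤ k × k < countAtLeast v σ)
positive-positions l v k 1≤v = mk⇔
  (λ e → ≮⇒≥ (λ k<c → <⇒≱ (countAtLeast-sound l _ k k<c) (≤-reflexive e)) ,
         <countAtLeast l v 1≤v k (≤-reflexive (sym e)))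
  (λ (c≤k , k<c) → ≤-antisym (≮⇒≥ λ v<nth → ≤⇒≯ c≤k (<countAtLeast l (suc v) (s≤s z≤n) k v<nth))
                             (countAtLeast-sound l v k k<c))

zero-positions : ∀ {σ} → Decreasing σ → ∀ k → nth σ k ≡ 0 ⇔ countAtLeast 1 σ ≤ k
zero-positions {σ} l k = mk⇔
  (λ e → ≮⇒≥ λ k<c → <⇒≱ (countAtLeast-sound l 1 k k<c) (≤-reflexive e))
  (λ c≤k → n≤0⇒n≡0 (≮⇒≥ λ 0<nth → ≤⇒≯ c≤k (<countAtLeast l 1 ≤-refl k 0<nth)))

interval-at : ∀ {σ} → Decreasing σ → ∀ j → ∃[ a ] ∃[ b ] IsPInterval σ (nth σ j) a b
interval-at {σ} l j with nth σ j in e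
... | zero = fin (suc (countAtLeast 1 σ)) , ∞ , fin≤fin (s≤s z≤n) , x≤∞ , iff
  where
  iff : ∀ i → Idx i → (val σ i ≡ 0 ⇔ (fin (suc (countAtLeast 1 σ)) ≤ᵉ i × i ≤ᵉ ∞))
  iff (fin zero) ix = ⊥-elim (¬Idx-0 ix)
  iff (fin (suc k)) _ = mk⇔ (λ e → fin≤fin (s≤s (Equivalence.to (zero-positions l k) e)) , x≤∞)
                            (λ { (fin≤fin (s≤s c≤k) , _) → Equivalence.from (zero-positions l k) c≤k })
  iff ∞ _ = mk⇔ (λ _ → x≤∞ , x≤∞) (λ _ → refl)
... | suc v = fin (suc (countAtLeast (suc (suc v)) σ)) , fin (countAtLeast (suc v) σ) ,
              fin≤fin (s≤s z≤n) , fin≤fin (<-≤-trans (s≤s (proj₁ j-bounds)) (proj₂ j-bounds)) , iff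
  where
  1≤v : 1 ≤ suc v
  1≤v = s≤s z≤n
  j-bounds : countAtLeast (suc (suc v)) σ ≤ j × j < countAtLeast (suc v) σ
  j-bounds = Equivalence.to (positive-positions l (suc v) j 1≤v) e
  iff : ∀ i → Idx i →
    (val σ i ≡ suc v ⇔ (fin (suc (countAtLeast (suc (suc v)) σ)) ≤ᵉ i × i ≤ᵉ fin (countAtLeast (suc v) σ)))
  iff (fin zero) ix = ⊥-elim (¬Idx-0 ix)
  iff (fin (suc k)) _ = mk⇔
    (λ e → let (c≤k , k<c) = Equivalence.to (positive-positions l (suc v) k 1≤v) e
           in fin≤fin (s≤s c≤k) , fin≤fin k<c)
    (λ { (fin≤fin (s≤s c≤k) , fin≤fin k<c) → Equivalence.from (positive-positions l (suc v) k 1≤v) (c≤k , k<c) })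
  iff ∞ _ = mk⇔ (λ ()) (λ { (_ , ()) })

splice : ℕ → List ℕ → List ℕ → List ℕ
splice k σ ρ = take k σ ++ drop k ρ

drop-suc : ∀ k (ρ : List ℕ) → drop (suc k) ρ ≡ drop k (drop 1 ρ)
drop-suc k ρ = sym (List.drop-drop 1 k ρ)

nth-suc : ∀ ρ j → nth ρ (suc j) ≡ nth (drop 1 ρ) j
nth-suc [] j = refl
nth-suc (x ∷ ρ) j = refl

nth-splice-below : ∀ k σ ρ j → k ≤ length σ → j < k → nth (splice k σ ρ) j ≡ nth σ j
nth-splice-below (suc k) (x ∷ σ) ρ zero _ _ = refl
nth-splice-below (suc k) (x ∷ σ) ρ (suc j) (s≤s k≤σ) (s≤s j<k)
  rewrite drop-suc k ρ = nth-splice-below k σ (drop 1 ρ) j k≤σ j<k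

nth-splice-above : ∀ k σ ρ j → k ≤ length σ → k ≤ j → nth (splice k σ ρ) j ≡ nth ρ j
nth-splice-above zero σ ρ j _ _ = refl
nth-splice-above (suc k) (x ∷ σ) ρ (suc j) (s≤s k≤σ) (s≤s k≤j)
  rewrite drop-suc k ρ = trans (nth-splice-above k σ (drop 1 ρ) j k≤σ k≤j) (sym (nth-suc ρ j))

take-splice : ∀ k σ ρ → k ≤ length σ → take k (splice k σ ρ) ≡ take k σ
take-splice zero σ ρ _ = refl
take-splice (suc k) (x ∷ σ) ρ (s≤s k≤σ)
  rewrite drop-suc k ρ = cong (x ∷_) (take-splice k σ (drop 1 ρ) k≤σ)

drop-splice : ∀ k σ ρ → k ≤ length σ → drop k (splice k σ ρ) ≡ drop k ρ
drop-splice zero σ ρ _ = refl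
drop-splice (suc k) (x ∷ σ) ρ (s≤s k≤σ)
  rewrite drop-suc k ρ = drop-splice k σ (drop 1 ρ) k≤σ

take-take-≤ : ∀ k n (σ : List ℕ) → k ≤ n → take k (take n σ) ≡ take k σ
take-take-≤ k n σ k≤n = trans (List.take-take k n σ) (cong (λ m → take m σ) (m≤n⇒m⊓n≡m k≤n))

splice-cong : ∀ {k n c} σ σ' ρ ρ' → c ≤ k → k ≤ n →
  take n σ ≡ take n σ' → drop c ρ ≡ drop c ρ' → splice k σ ρ ≡ splice k σ' ρ'
splice-cong {k} {n} {c} σ σ' ρ ρ' c≤k k≤n heads tails with m≤n⇒∃[o]m+o≡n c≤k
... | d , refl = cong₂ _++_
  (trans (sym (take-take-≤ k n σ k≤n)) (trans (cong (take k) heads) (take-take-≤ k n σ' k≤n)))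
  (trans (sym (List.drop-drop c d ρ)) (trans (cong (drop d) tails) (List.drop-drop c d ρ')))

-- σ and ρ are joinable at k when the splice does not increase across the cut:
-- ρ_{k+1} < σ_k (1-based).  Strictness forces σ to have k positive entries.
Joinable : ℕ → List ℕ → List ℕ → Set
Joinable zero σ ρ = ⊤
Joinable (suc k) σ ρ = nth ρ (suc k) < nth σ k

joinable-length : ∀ k σ ρ → Joinable k σ ρ → k ≤ length σ
joinable-length zero σ ρ _ = z≤n
joinable-length (suc k) σ ρ st = nth-length σ k (≤-trans (s≤s z≤n) st)

joinable-from : ∀ k σ ρ → Decreasing σ → nth ρ k < nth σ k → Joinable k σ ρ
joinable-from zero σ ρ _ _ = tt
joinable-from (suc k) σ ρ l h = ≤-trans h (nth-step l k)

splice-isPartition : ∀ k σ ρ → IsPartition σ → IsPartition ρ → Joinable k σ ρ →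
  IsPartition (splice k σ ρ)
splice-isPartition k σ ρ (posσ , decσ) (posρ , decρ) st =
  ++⁺ (take⁺ k posσ) (drop⁺ k posρ) , decreasing-from-steps _ step
  where
  k≤σ : k ≤ length σ
  k≤σ = joinable-length k σ ρ st
  -- the only step that crosses the cut is from position k - 1 to k
  across-cut : ∀ k i → Joinable k σ ρ → i < k → ¬ suc i < k → nth ρ (suc i) ≤ nth σ i
  across-cut (suc k) i st i<k i+1≮k with ≤-antisym (≤-pred i<k) (≤-pred (≮⇒≥ i+1≮k))
  ... | refl = <⇒≤ st
  step : ∀ i → nth (splice k σ ρ) (suc i) ≤ nth (splice k σ ρ) i
  step i with suc i <? k | i <? k
  ... | yes i+1<k | _
    rewrite nth-splice-below k σ ρ (suc i) k≤σ i+1<k | nth-splice-below k σ ρ i k≤σ (<-trans (n<1+n i) i+1<k)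
    = nth-step decσ i
  ... | no i+1≮k | yes i<k
    rewrite nth-splice-above k σ ρ (suc i) k≤σ (≮⇒≥ i+1≮k) | nth-splice-below k σ ρ i k≤σ i<k
    = across-cut k i st i<k i+1≮k
  ... | no i+1≮k | no i≮k
    rewrite nth-splice-above k σ ρ (suc i) k≤σ (≮⇒≥ i+1≮k) | nth-splice-above k σ ρ i k≤σ (≮⇒≥ i≮k)
    = nth-step decρ i

-- τ is dominated by Q when each interval of τ lies inside an interval, of the
-- same value, of some member of Q.  Dominated partitions are invisible to the
-- profile (sameProfile-insert below).
Dominated : List Partition → Partition → Set
Dominated Q τ = ∀ v a b → IsPInterval τ v a b →
  ∃[ σ ] (σ ∈ Q × ∃[ a' ] ∃[ b' ] (IsPInterval σ v a' b' × (a , b) ⊆ᴵ (a' , b')))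

interval-inside : ∀ {τ σ v a b j} → Decreasing σ → IsPInterval τ v a b → a ≡ fin (suc j) →
  (∀ i → InInt a b i → val σ i ≡ v) →
  ∃[ a' ] ∃[ b' ] (IsPInterval σ v a' b' × (a , b) ⊆ᴵ (a' , b'))
interval-inside {j = j} decσ I refl agree with interval-at decσ j
... | a' , b' , J with agree (fin (suc j)) (PInterval.Idx-start I , ≤ᵉ-refl , PInterval.start≤end I)
... | refl = a' , b' , J , λ i ii → proj₁ ii , Equivalence.to (proj₂ (proj₂ J) i (proj₁ ii)) (agree i ii)

-- An interval of a splice starting below a joinable cut ends below it: the
-- value strictly drops across the cut.
splice-interval-below : ∀ k σ ρ → Decreasing σ → Decreasing ρ → Joinable k σ ρ →
  ∀ {v j b} → IsPInterval (splice k σ ρ) v (fin (suc j)) b → j < k →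
  ∀ i → InInt (fin (suc j)) b i → val σ i ≡ v
splice-interval-below k σ ρ decσ decρ st I j<k (fin zero) (ix , _) = ⊥-elim (¬Idx-0 ix)
splice-interval-below k σ ρ decσ decρ st I j<k ∞ ii = PInterval.value-inside I ∞ ii
splice-interval-below k σ ρ decσ decρ st {v} {j} I j<k (fin (suc i)) ii@(_ , fin≤fin (s≤s j≤i) , _)
  with i <? k
... | yes i<k = trans (sym (nth-splice-below k σ ρ i (joinable-length k σ ρ st) i<k)) (PInterval.value-inside I _ ii)
... | no i≮k = ⊥-elim (value-drops k st j<k (≮⇒≥ i≮k))
  where
  open PInterval I
  k≤σ : k ≤ length σ
  k≤σ = joinable-length k σ ρ st
  value-drops : ∀ m → Joinable m σ ρ → j < m → m ≤ i → ⊥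
  value-drops (suc k') st (s≤s j≤k') k≤i = <-irrefl refl (begin-strict
    v                 ≡⟨ sym (value-inside _ ii) ⟩
    nth (splice k σ ρ) i ≡⟨ nth-splice-above k σ ρ i k≤σ (≮⇒≥ i≮k) ⟩
    nth ρ i           ≤⟨ nth-mono decρ k≤i ⟩
    nth ρ (suc k')    <⟨ st ⟩
    nth σ k'          ≤⟨ nth-mono decσ j≤k' ⟩
    nth σ j           ≡⟨ sym (nth-splice-below k σ ρ j k≤σ j<k) ⟩
    nth (splice k σ ρ) j ≡⟨ value-start ⟩
    v                 ∎)
    where open ≤-Reasoning

splice-interval-above : ∀ k σ ρ → Joinable k σ ρ →
  ∀ {v j b} → IsPInterval (splice k σ ρ) v (fin (suc j)) b → k ≤ j →
  ∀ i → InInt (fin (suc j)) b i → val ρ i ≡ v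
splice-interval-above k σ ρ st I k≤j (fin zero) (ix , _) = ⊥-elim (¬Idx-0 ix)
splice-interval-above k σ ρ st I k≤j ∞ ii = PInterval.value-inside I ∞ ii
splice-interval-above k σ ρ st I k≤j (fin (suc i)) ii@(_ , fin≤fin (s≤s j≤i) , _) =
  trans (sym (nth-splice-above k σ ρ i (joinable-length k σ ρ st) (≤-trans k≤j j≤i)))
        (PInterval.value-inside I _ ii)

splice-dominated : ∀ {Q} k σ ρ → σ ∈ Q → ρ ∈ Q → IsPartition σ → IsPartition ρ →
  Joinable k σ ρ → Dominated Q (splice k σ ρ)
splice-dominated k σ ρ σ∈Q ρ∈Q (_ , decσ) (_ , decρ) st v a b I with PInterval.start-fin I
... | j , refl with j <? k
... | yes j<k = σ , σ∈Q , interval-inside decσ I refl (splice-interval-below k σ ρ decσ decρ st I j<k)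
... | no j≮k = ρ , ρ∈Q , interval-inside decρ I refl (splice-interval-above k σ ρ st I (≮⇒≥ j≮k))

-- Adding a partition dominated by Small to Small does not change the profile:
-- its intervals are never maximal unless they already occur in Small.
sameProfile-insert : ∀ {Big Small τ} → Dominated Small τ →
  (∀ σ → σ ∈ Big → σ ≡ τ ⊎ σ ∈ Small) → (∀ σ → σ ∈ Small → σ ∈ Big) →
  SameProfile Big Small
sameProfile-insert {Big} {Small} {τ} dom split incl v a b = mk⇔ to from
  where
  to : InProfile Big v a b → InProfile Small v a b
  to ((σ , σ∈B , I) , maximal) =
    witness (split σ σ∈B) , λ σ' a' b' σ'∈S I' ⊆ → maximal σ' a' b' (incl σ' σ'∈S) I' ⊆
    where
    witness : σ ≡ τ ⊎ σ ∈ Small → ∃[ σ ] (σ ∈ Small × IsPInterval σ v a b)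
    witness (inj₂ σ∈S) = σ , σ∈S , I
    witness (inj₁ refl) with dom v a b I
    ... | σ' , σ'∈S , a' , b' , I' , ⊆
      with ⊆ᴵ-antisym (PInterval.Idx-start I) (PInterval.start≤end I) (PInterval.Idx-start I') (PInterval.start≤end I')
                      ⊆ (maximal σ' a' b' (incl σ' σ'∈S) I' ⊆)
    ... | refl , refl = σ' , σ'∈S , I'
  from : InProfile Small v a b → InProfile Big v a b
  from ((σ , σ∈S , I) , maximal) = (σ , incl σ σ∈S , I) , λ σ' a' b' σ'∈B I' ⊆ → still-maximal (split σ' σ'∈B) I' ⊆
    where
    still-maximal : ∀ {σ' a' b'} → σ' ≡ τ ⊎ σ' ∈ Small → IsPInterval σ' v a' b' →
      (a , b) ⊆ᴵ (a' , b') → (a' , b') ⊆ᴵ (a , b)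
    still-maximal (inj₂ σ'∈S) I' ⊆ = maximal _ _ _ σ'∈S I' ⊆
    still-maximal {a' = a'} {b'} (inj₁ refl) I' ⊆ with dom v a' b' I'
    ... | ρ , ρ∈S , a'' , b'' , J , ⊆' =
      ⊆ᴵ-trans {a' , b'} {a'' , b''} {a , b} ⊆' (maximal ρ a'' b'' ρ∈S J (⊆ᴵ-trans {a , b} {a' , b'} {a'' , b''} ⊆ ⊆'))

sameProfile-trans : ∀ {X Y Z} → SameProfile X Y → SameProfile Y Z → SameProfile X Z
sameProfile-trans f g v a b = ⇔-trans (f v a b) (g v a b)

sameProfile-sym : ∀ {X Y} → SameProfile X Y → SameProfile Y X
sameProfile-sym f v a b = ⇔-sym (f v a b)

_≟ₚ_ : (σ τ : Partition) → Dec (σ ≡ τ)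
_≟ₚ_ = List.≡-dec _≟_

remove : Partition → List Partition → List Partition
remove τ = filter (λ σ → ¬? (σ ≟ₚ τ))

∈-remove⁻ : ∀ {τ σ} Q → σ ∈ remove τ Q → σ ∈ Q × σ ≢ τ
∈-remove⁻ {τ} Q = ∈-filter⁻ (λ σ → ¬? (σ ≟ₚ τ))

∈-remove⁺ : ∀ {τ σ} Q → σ ∈ Q → σ ≢ τ → σ ∈ remove τ Q
∈-remove⁺ {τ} Q = ∈-filter⁺ (λ σ → ¬? (σ ≟ₚ τ))

length-remove : ∀ {τ} Q → τ ∈ Q → suc (length (remove τ Q)) ≤ length Q
length-remove {τ} Q τ∈Q = List.filter-notAll (λ σ → ¬? (σ ≟ₚ τ)) Q (Any.map (λ τ≡σ σ≢τ → σ≢τ (sym τ≡σ)) τ∈Q)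

unique-length-≤ : ∀ Q Q' → AllPairs _≢_ Q → (∀ σ → σ ∈ Q → σ ∈ Q') → length Q ≤ length Q'
unique-length-≤ [] Q' _ _ = z≤n
unique-length-≤ (x ∷ Q) Q' (x∉Q ∷ uniq) sub =
  ≤-trans (s≤s (unique-length-≤ Q (remove x Q') uniq λ σ σ∈Q → ∈-remove⁺ Q' (sub σ (there σ∈Q)) (≢x σ∈Q)))
          (length-remove Q' (sub x (here refl)))
  where
  ≢x : ∀ {σ} → σ ∈ Q → σ ≢ x
  ≢x σ∈Q refl = All.lookup x∉Q σ∈Q refl

setEq-length : ∀ {Q Q'} → AllPairs _≢_ Q → AllPairs _≢_ Q' → SetEq Q Q' → length Q ≡ length Q'
setEq-length {Q} {Q'} u u' e =
  ≤-antisym (unique-length-≤ Q Q' u λ σ → Equivalence.to (e σ)) (unique-length-≤ Q' Q u' λ σ → Equivalence.from (e σ))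

setEq-sym : ∀ {X Y} → SetEq X Y → SetEq Y X
setEq-sym e σ = ⇔-sym (e σ)

setEq-trans : ∀ {X Y Z} → SetEq X Y → SetEq Y Z → SetEq X Z
setEq-trans e f σ = ⇔-trans (e σ) (f σ)

toggle : Partition → List Partition → List Partition
toggle τ Q with τ ∈? Q
... | yes _ = remove τ Q
... | no _ = τ ∷ Q

toggle-other : ∀ τ Q σ → σ ≢ τ → (σ ∈ toggle τ Q ⇔ σ ∈ Q)
toggle-other τ Q σ σ≢τ with τ ∈? Q
... | yes _ = mk⇔ (λ m → proj₁ (∈-remove⁻ Q m)) (λ m → ∈-remove⁺ Q m σ≢τ)
... | no _ = mk⇔ (λ { (here e) → ⊥-elim (σ≢τ e) ; (there m) → m }) there

toggle-self : ∀ τ Q → τ ∈ toggle τ Q ⇔ τ ∉ Q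
toggle-self τ Q with τ ∈? Q
... | yes τ∈Q = mk⇔ (λ m → ⊥-elim (proj₂ (∈-remove⁻ Q m) refl)) (λ τ∉Q → ⊥-elim (τ∉Q τ∈Q))
... | no τ∉Q = mk⇔ (λ _ → τ∉Q) (λ _ → here refl)

toggle-length : ∀ τ Q → AllPairs _≢_ Q →
  length (toggle τ Q) ≡ suc (length Q) ⊎ length Q ≡ suc (length (toggle τ Q))
toggle-length τ Q uniq with τ ∈? Q
... | no _ = inj₁ refl
... | yes τ∈Q = inj₂ (≤-antisym (unique-length-≤ Q (τ ∷ remove τ Q) uniq τ-or-rest) (length-remove Q τ∈Q))
  where
  τ-or-rest : ∀ σ → σ ∈ Q → σ ∈ τ ∷ remove τ Q
  τ-or-rest σ σ∈Q with σ ≟ₚ τ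
  ... | yes e = here e
  ... | no σ≢τ = there (∈-remove⁺ Q σ∈Q σ≢τ)

toggle-involutive : ∀ {X Q} τ → SetEq X (toggle τ Q) → SetEq (toggle τ X) Q
toggle-involutive {X} {Q} τ e σ with σ ≟ₚ τ
... | no σ≢τ = ⇔-trans (toggle-other τ X σ σ≢τ) (⇔-trans (e σ) (toggle-other τ Q σ σ≢τ))
... | yes refl = mk⇔
  (λ σ∈X' → decidable-stable (σ ∈? Q) λ σ∉Q →
     Equivalence.to (toggle-self σ X) σ∈X' (Equivalence.from (e σ) (Equivalence.from (toggle-self σ Q) σ∉Q)))
  (λ σ∈Q → Equivalence.from (toggle-self σ X) λ σ∈X → Equivalence.to (toggle-self σ Q) (Equivalence.to (e σ) σ∈X) σ∈Q)

member-decreasing : ∀ {Q σ} → All IsPartition Q → σ ∈ Q → Decreasing σ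
member-decreasing parts σ∈Q = proj₂ (All.lookup parts σ∈Q)

SpliceOfOthers : List Partition → Partition → Set
SpliceOfOthers Q τ = ∃[ k ] ∃[ σ ] ∃[ ρ ]
  (σ ∈ Q × ρ ∈ Q × σ ≢ τ × ρ ≢ τ × τ ≡ splice k σ ρ × Joinable k σ ρ)

spliceOfOthers-dominated : ∀ {Q τ} → All IsPartition Q → SpliceOfOthers Q τ → Dominated (remove τ Q) τ
spliceOfOthers-dominated {Q} parts (k , σ , ρ , σ∈Q , ρ∈Q , σ≢τ , ρ≢τ , refl , st) =
  splice-dominated k σ ρ (∈-remove⁺ Q σ∈Q σ≢τ) (∈-remove⁺ Q ρ∈Q ρ≢τ)
                   (All.lookup parts σ∈Q) (All.lookup parts ρ∈Q) st

spliceOfOthers-isPartition : ∀ {Q τ} → All IsPartition Q → SpliceOfOthers Q τ → IsPartition τ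
spliceOfOthers-isPartition parts (k , σ , ρ , σ∈Q , ρ∈Q , _ , _ , refl , st) =
  splice-isPartition k σ ρ (All.lookup parts σ∈Q) (All.lookup parts ρ∈Q) st

toggle-sameProfile : ∀ {Q τ} → All IsPartition Q → SpliceOfOthers Q τ → SameProfile (toggle τ Q) Q
toggle-sameProfile {Q} {τ} parts sp with τ ∈? Q
... | yes _ = sameProfile-sym (sameProfile-insert dom split (λ σ m → proj₁ (∈-remove⁻ Q m)))
  where
  dom : Dominated (remove τ Q) τ
  dom = spliceOfOthers-dominated parts sp
  split : ∀ σ → σ ∈ Q → σ ≡ τ ⊎ σ ∈ remove τ Q
  split σ σ∈Q with σ ≟ₚ τ
  ... | yes e = inj₁ e
  ... | no σ≢τ = inj₂ (∈-remove⁺ Q σ∈Q σ≢τ)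
... | no _ = sameProfile-insert dom split (λ _ → there)
  where
  dom : Dominated Q τ
  dom v a b I with spliceOfOthers-dominated parts sp v a b I
  ... | σ , σ∈Q' , rest = σ , proj₁ (∈-remove⁻ Q σ∈Q') , rest
  split : ∀ σ → σ ∈ τ ∷ Q → σ ≡ τ ⊎ σ ∈ Q
  split σ (here e) = inj₁ e
  split σ (there m) = inj₂ m

toggle-isFinSet : ∀ {Q τ} → IsFinSetPart Q → SpliceOfOthers Q τ → IsFinSetPart (toggle τ Q)
toggle-isFinSet {Q} {τ} (parts , uniq) sp with τ ∈? Q
... | yes _ = All.filter⁺ _ parts , AllPairs.filter⁺ _ uniq
... | no τ∉Q = (spliceOfOthers-isPartition parts sp ∷ parts) ,
               (All.tabulate (λ σ∈Q τ≡σ → τ∉Q (subst (_∈ Q) (sym τ≡σ) σ∈Q)) ∷ uniq)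

toggle-inClass : ∀ {P₀ Q τ} → InClassOf P₀ Q → SpliceOfOthers Q τ → InClassOf P₀ (toggle τ Q)
toggle-inClass {Q = Q} {τ} (finSet , _ , same) sp@(_ , σ , _ , σ∈Q , _ , σ≢τ , _) =
  toggle-isFinSet finSet sp ,
  (σ , Equivalence.from (toggle-other τ Q σ σ≢τ) σ∈Q) ,
  sameProfile-trans (toggle-sameProfile (proj₁ finSet) sp) same

index-unique : ∀ {A : Set} {R : A → A → Set} → (∀ {x y} → R x y → R y x) → ∀ {L} →
  AllPairs (λ x y → ¬ R x y) L → ∀ i j → R (lookup L i) (lookup L j) → i ≡ j
index-unique R-sym (_ ∷ _) fzero fzero _ = refl
index-unique R-sym (apart ∷ _) fzero (fsuc j) r = ⊥-elim (All.lookup apart (∈-lookup j) r)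
index-unique R-sym (apart ∷ _) (fsuc i) fzero r = ⊥-elim (All.lookup apart (∈-lookup i) (R-sym r))
index-unique R-sym (_ ∷ pairs) (fsuc i) (fsuc j) r = cong fsuc (index-unique R-sym pairs i j r)

sign : ℕ → ℤ
sign n = -1ℤ ^ℤ n

sign-suc : ∀ n → sign (suc n) ≡ - sign n
sign-suc n = ℤ.-1*i≡-i (sign n)

toggle-sign : ∀ τ Q → AllPairs _≢_ Q → sign (length (toggle τ Q)) ≡ - sign (length Q)
toggle-sign τ Q uniq with toggle-length τ Q uniq
... | inj₁ grows = trans (cong sign grows) (sign-suc (length Q))
... | inj₂ shrinks = begin
  sign (length (toggle τ Q))           ≡⟨ ℤ.neg-involutive _ ⟨
  - - sign (length (toggle τ Q))       ≡⟨ cong -_ (sign-suc (length (toggle τ Q))) ⟨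
  - sign (suc (length (toggle τ Q)))   ≡⟨ cong (λ m → - sign m) shrinks ⟨
  - sign (length Q)                    ∎
  where open ≡-Reasoning

-- The signed sum as a sum over the positions of L, to permute them.
signedSum-as-sum : ∀ L → signedSum L ≡ sum (λ i → sign (length (lookup L i)))
signedSum-as-sum [] = refl
signedSum-as-sum (P ∷ L) = cong (sign (length P) +ℤ_) (signedSum-as-sum L)

sum-neg : ∀ {n} (f : Fin n → ℤ) → sum (λ i → - f i) ≡ - sum f
sum-neg {zero} f = refl
sum-neg {suc n} f =
  trans (cong (- f fzero +ℤ_) (sum-neg (λ i → f (fsuc i)))) (sym (ℤ.neg-distrib-+ (f fzero) _))

self-negating : ∀ x → x ≡ - x → x ≡ 0ℤ
self-negating (+ zero) _ = refl
self-negating (+ suc _) ()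
self-negating -[1+ _ ] ()

-- Suppose every member Q of the profile class of P₀ has a
-- unique chosen partition τ (depending only on Q as a set), which is a
-- joinable splice of two other members and is still the choice of Q △ {τ}.
-- Then Q ↦ Q △ {τ} is an involution of the class that flips (-1)^|Q|, so the
-- signed sum over the class vanishes.
module SignReversingInvolution {P₀ : List Partition} (Choice : List Partition → Partition → Set)
  (choice-exists : ∀ Q → InClassOf P₀ Q → ∃[ τ ] Choice Q τ)
  (choice-unique : ∀ {Q τ τ'} → Choice Q τ → Choice Q τ' → τ ≡ τ')
  (choice-setEq : ∀ {Q Q' τ} → SetEq Q Q' → Choice Q τ → Choice Q' τ)
  (choice-toggle : ∀ {Q τ} → InClassOf P₀ Q → Choice Q τ → Choice (toggle τ Q) τ)
  (choice-splice : ∀ {Q τ} → InClassOf P₀ Q → Choice Q τ → SpliceOfOthers Q τ)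
  (L : List (List Partition)) (enum : EnumeratesClass P₀ L)
  where

  private
    n : ℕ
    n = length L

    member : Fin n → List Partition
    member i = lookup L i

    member-inClass : ∀ i → InClassOf P₀ (member i)
    member-inClass i = All.lookup (proj₁ enum) (∈-lookup i)

    chosen : Fin n → Partition
    chosen i = proj₁ (choice-exists (member i) (member-inClass i))

    chosen-is : ∀ i → Choice (member i) (chosen i)
    chosen-is i = proj₂ (choice-exists (member i) (member-inClass i))

    toggled : Fin n → List Partition
    toggled i = toggle (chosen i) (member i)

    toggled-inClass : ∀ i → InClassOf P₀ (toggled i)
    toggled-inClass i = toggle-inClass (member-inClass i) (choice-splice (member-inClass i) (chosen-is i))

    toggled-listed : ∀ i → Any (SetEq (toggled i)) L
    toggled-listed i = proj₂ (proj₂ enum) (toggled i) (toggled-inClass i)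

    partner : Fin n → Fin n
    partner i = Any.index (toggled-listed i)

    partner-setEq : ∀ i → SetEq (toggled i) (member (partner i))
    partner-setEq i = lookup-index (toggled-listed i)

    partner-involutive : ∀ i → partner (partner i) ≡ i
    partner-involutive i =
      index-unique setEq-sym (proj₁ (proj₂ enum)) _ _ (setEq-sym (setEq-trans back (partner-setEq j)))
      where
      j : Fin n
      j = partner i
      same-choice : chosen j ≡ chosen i
      same-choice = choice-unique (chosen-is j)
                      (choice-setEq (partner-setEq i) (choice-toggle (member-inClass i) (chosen-is i)))
      back : SetEq (member i) (toggled j)
      back = subst (λ τ → SetEq (member i) (toggle τ (member j))) (sym same-choice)
                   (setEq-sym (toggle-involutive (chosen i) (setEq-sym (partner-setEq i))))

    partner-permutation : Permutation n n
    partner-permutation = permutation partner partner partner-involutive partner-involutive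

    weight : Fin n → ℤ
    weight i = sign (length (member i))

    partner-weight : ∀ i → weight (partner i) ≡ - weight i
    partner-weight i = trans (cong sign (sym same-size))
                             (toggle-sign (chosen i) (member i) (proj₂ (proj₁ (member-inClass i))))
      where
      same-size : length (toggled i) ≡ length (member (partner i))
      same-size = setEq-length (proj₂ (proj₁ (toggled-inClass i))) (proj₂ (proj₁ (member-inClass (partner i))))
                               (partner-setEq i)

  signedSum-vanishes : signedSum L ≡ 0ℤ
  signedSum-vanishes = self-negating _ (begin
    signedSum L                    ≡⟨ signedSum-as-sum L ⟩
    sum weight                     ≡⟨ sum-permute weight partner-permutation ⟩
    sum (λ i → weight (partner i)) ≡⟨ sum-cong-≗ partner-weight ⟩
    sum (λ i → - weight i)         ≡⟨ sum-neg weight ⟩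
    - sum weight                   ≡⟨ cong -_ (signedSum-as-sum L) ⟨
    - signedSum L                  ∎)
    where open ≡-Reasoning

-- Lexicographic order on lists of naturals (a decidable total order), used to
-- make canonical choices.
module Lex = DecTotalOrder (lex-decTotalOrder ≤-decTotalOrder)

_≤ˡ_ : List ℕ → List ℕ → Set
_≤ˡ_ = Lex._≤_

≤ˡ-antisym : ∀ {xs ys} → xs ≤ˡ ys → ys ≤ˡ xs → xs ≡ ys
≤ˡ-antisym xs≤ys ys≤xs = Pointwise-≡⇒≡ (Lex.antisym xs≤ys ys≤xs)

IsLeast : (List ℕ → Set) → List ℕ → Set
IsLeast S m = S m × (∀ x → S x → m ≤ˡ x)

isLeast-unique : ∀ {S m m'} → IsLeast S m → IsLeast S m' → m ≡ m'
isLeast-unique (m∈S , m≤) (m'∈S , m'≤) = ≤ˡ-antisym (m≤ _ m'∈S) (m'≤ _ m∈S)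

isLeast-resp : ∀ {S S' : List ℕ → Set} {m} → (∀ t → S t ⇔ S' t) → IsLeast S m → IsLeast S' m
isLeast-resp S⇔S' (m∈S , m≤) = Equivalence.to (S⇔S' _) m∈S , λ x x∈S' → m≤ x (Equivalence.from (S⇔S' x) x∈S')

ExIn : List Partition → (Partition → Set) → Set
ExIn Q P = ∃[ σ ] (σ ∈ Q × P σ)

Image : List Partition → (Partition → Set) → (Partition → List ℕ) → List ℕ → Set
Image Q P f t = ExIn Q (λ σ → P σ × f σ ≡ t)

exIn-∷ : ∀ {x Q P} → ExIn (x ∷ Q) P → P x ⊎ ExIn Q P
exIn-∷ (σ , here refl , pσ) = inj₁ pσ
exIn-∷ (σ , there σ∈Q , pσ) = inj₂ (σ , σ∈Q , pσ)

exIn? : ∀ {P : Partition → Set} → (∀ σ → Dec (P σ)) → ∀ Q → Dec (ExIn Q P)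
exIn? P? [] = no λ ()
exIn? P? (x ∷ Q) with P? x | exIn? P? Q
... | yes px | _ = yes (x , here refl , px)
... | no _ | yes (σ , σ∈Q , pσ) = yes (σ , there σ∈Q , pσ)
... | no ¬px | no none = no λ e → [ ¬px , none ]′ (exIn-∷ e)

module _ {P : Partition → Set} {f : Partition → List ℕ} {x : Partition} {Q : List Partition} where

  least-extend : ∀ {m} → (P x → m ≤ˡ f x) → IsLeast (Image Q P f) m → IsLeast (Image (x ∷ Q) P f) m
  least-extend {m} m≤fx ((σ , σ∈Q , pσ) , least) = (σ , there σ∈Q , pσ) , below
    where
    below : ∀ t → Image (x ∷ Q) P f t → m ≤ˡ t
    below t i with exIn-∷ i
    ... | inj₁ (px , refl) = m≤fx px
    ... | inj₂ i' = least t i'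

  least-head : P x → (∀ t → Image Q P f t → f x ≤ˡ t) → IsLeast (Image (x ∷ Q) P f) (f x)
  least-head px fx≤ = (x , here refl , px , refl) , below
    where
    below : ∀ t → Image (x ∷ Q) P f t → f x ≤ˡ t
    below t i with exIn-∷ i
    ... | inj₁ (_ , refl) = Lex.refl
    ... | inj₂ i' = fx≤ t i'

  least-cons : P x → ∀ {m} → IsLeast (Image Q P f) m → ∃[ m' ] IsLeast (Image (x ∷ Q) P f) m'
  least-cons px {m} least@(_ , m≤) with Lex.total (f x) m
  ... | inj₁ fx≤m = f x , least-head px (λ t i → Lex.trans fx≤m (m≤ t i))
  ... | inj₂ m≤fx = m , least-extend (λ _ → m≤fx) least

least-image : ∀ {P : Partition → Set} → (∀ σ → Dec (P σ)) → (f : Partition → List ℕ) → ∀ Q →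
  ExIn Q P → ∃[ m ] IsLeast (Image Q P f) m
least-image P? f [] ()
least-image P? f (x ∷ Q) e with P? x | exIn? P? Q
... | no ¬px | no none = ⊥-elim ([ ¬px , none ]′ (exIn-∷ e))
... | no ¬px | yes some = let (m , least) = least-image P? f Q some in m , least-extend (λ px → ⊥-elim (¬px px)) least
... | yes px | no none = f x , least-head px λ { t (σ , σ∈Q , pσ , _) → ⊥-elim (none (σ , σ∈Q , pσ)) }
... | yes px | yes some = least-cons px (proj₂ (least-image P? f Q some))

exIn-setEq : ∀ {Q Q' P} → SetEq Q Q' → ExIn Q P ⇔ ExIn Q' P
exIn-setEq Q≈Q' = mk⇔ (λ (σ , σ∈Q , pσ) → σ , Equivalence.to (Q≈Q' σ) σ∈Q , pσ)
                      (λ (σ , σ∈Q' , pσ) → σ , Equivalence.from (Q≈Q' σ) σ∈Q' , pσ)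

exIn-toggle : ∀ {Q τ P} → (P τ → ExIn Q (λ σ → σ ≢ τ × P σ)) → ExIn Q P ⇔ ExIn (toggle τ Q) P
exIn-toggle {Q} {τ} {P} other = mk⇔ to from
  where
  to : ExIn Q P → ExIn (toggle τ Q) P
  to (σ , σ∈Q , pσ) with σ ≟ₚ τ
  ... | no σ≢τ = σ , Equivalence.from (toggle-other τ Q σ σ≢τ) σ∈Q , pσ
  ... | yes refl with other pσ
  ...   | σ' , σ'∈Q , σ'≢τ , pσ' = σ' , Equivalence.from (toggle-other τ Q σ' σ'≢τ) σ'∈Q , pσ'
  from : ExIn (toggle τ Q) P → ExIn Q P
  from (σ , σ∈Q' , pσ) with σ ≟ₚ τ
  ... | no σ≢τ = σ , Equivalence.to (toggle-other τ Q σ σ≢τ) σ∈Q' , pσ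
  ... | yes refl with other pσ
  ...   | σ' , σ'∈Q , _ , pσ' = σ' , σ'∈Q , pσ'

-- Fix 0-based positions c < k and thresholds r and
-- p ≥ 1.  A set Q containing upper and lower partitions (below) determines a
-- partition τ(Q): the splice of the least head of an upper member with the
-- least tail of a lower member, cut at a point chosen so that τ(Q) is a
-- joinable splice of two other members and Q △ {τ(Q)} has the same data.
module CanonicalSplice (c k r p : ℕ) (c<k : c < k) (1≤p : 1 ≤ p) where

  record Upper (σ : Partition) : Set where
    constructor upper
    field
      large-c : r < nth σ c
      large-k : p ≤ nth σ k

  record Lower (ρ : Partition) : Set where
    constructor lower
    field
      small-c : nth ρ c ≤ r
      small-k : nth ρ k < p

  open Upper
  open Lower

  upper? : ∀ σ → Dec (Upper σ)
  upper? σ = map′ (λ (x , y) → upper x y) (λ u → large-c u , large-k u) ((r <? nth σ c) ×-dec (p ≤? nth σ k))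

  lower? : ∀ ρ → Dec (Lower ρ)
  lower? ρ = map′ (λ (x , y) → lower x y) (λ l → small-c l , small-k l) ((nth ρ c ≤? r) ×-dec (nth ρ k <? p))

  upper-not-lower : ∀ {σ} → Upper σ → ¬ Lower σ
  upper-not-lower u l = <⇒≱ (large-c u) (small-c l)

  upper-resp : ∀ {σ τ} → nth τ c ≡ nth σ c → nth τ k ≡ nth σ k → Upper σ → Upper τ
  upper-resp ec ek u = upper (subst (r <_) (sym ec) (large-c u)) (subst (p ≤_) (sym ek) (large-k u))

  lower-resp : ∀ {ρ τ} → nth τ c ≡ nth ρ c → nth τ k ≡ nth ρ k → Lower ρ → Lower τ
  lower-resp ec ek l = lower (subst (_≤ r) (sym ec) (small-c l)) (subst (_< p) (sym ek) (small-k l))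

  upper-length : ∀ {σ} → Upper σ → suc k ≤ length σ
  upper-length {σ} u = nth-length σ k (≤-trans 1≤p (large-k u))

  c≤k : c ≤ k
  c≤k = <⇒≤ c<k

  -- The head of σ is σ₁ … σ_{k+1}, the tail of ρ is ρ_{c+1} …, and the rest of
  -- a tail is its part beyond the head.
  head : Partition → List ℕ
  head σ = take (suc k) σ

  tail : Partition → List ℕ
  tail ρ = drop c ρ

  rest : List ℕ → List ℕ
  rest t = drop (suc k ∸ c) t

  drop-head≡rest-tail : ∀ ρ → drop (suc k) ρ ≡ rest (tail ρ)
  drop-head≡rest-tail ρ = trans (cong (λ m → drop m ρ) (sym (m+[n∸m]≡n (m≤n⇒m≤1+n c≤k))))
                                (sym (List.drop-drop c (suc k ∸ c) ρ))

  LowerTails UpperHeads : List Partition → List ℕ → Set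
  LowerTails Q = Image Q Lower tail
  UpperHeads Q = Image Q Upper head

  -- Members that would also fit the splice data (t, h) but differ from the
  -- corresponding splice; their presence decides where to cut.
  UpperRival LowerRival : List ℕ → List ℕ → Partition → Set
  UpperRival t h σ = Upper σ × head σ ≡ h × drop (suc k) σ ≢ rest t
  LowerRival t h ρ = Lower ρ × tail ρ ≡ t × take c ρ ≢ take c h

  upperRival? : ∀ t h σ → Dec (UpperRival t h σ)
  upperRival? t h σ = upper? σ ×-dec ((head σ ≟ₚ h) ×-dec ¬? (drop (suc k) σ ≟ₚ rest t))

  lowerRival? : ∀ t h ρ → Dec (LowerRival t h ρ)
  lowerRival? t h ρ = lower? ρ ×-dec ((tail ρ ≟ₚ t) ×-dec ¬? (take c ρ ≟ₚ take c h))

  data Cut (Q : List Partition) (t h : List ℕ) : ℕ → Set where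
    cut-head : ExIn Q (UpperRival t h) → Cut Q t h (suc k)
    cut-at-c : ¬ ExIn Q (UpperRival t h) → ExIn Q (LowerRival t h) → Cut Q t h c
    cut-after-c : ¬ ExIn Q (UpperRival t h) → ¬ ExIn Q (LowerRival t h) → Cut Q t h (suc c)

  cut-exists : ∀ Q t h → ∃[ K ] Cut Q t h K
  cut-exists Q t h with exIn? (upperRival? t h) Q | exIn? (lowerRival? t h) Q
  ... | yes up | _ = suc k , cut-head up
  ... | no ¬up | yes low = c , cut-at-c ¬up low
  ... | no ¬up | no ¬low = suc c , cut-after-c ¬up ¬low

  cut-unique : ∀ {Q t h K K'} → Cut Q t h K → Cut Q t h K' → K ≡ K'
  cut-unique (cut-head _) (cut-head _) = refl
  cut-unique (cut-head up) (cut-at-c ¬up _) = ⊥-elim (¬up up)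
  cut-unique (cut-head up) (cut-after-c ¬up _) = ⊥-elim (¬up up)
  cut-unique (cut-at-c ¬up _) (cut-head up) = ⊥-elim (¬up up)
  cut-unique (cut-at-c _ _) (cut-at-c _ _) = refl
  cut-unique (cut-at-c _ low) (cut-after-c _ ¬low) = ⊥-elim (¬low low)
  cut-unique (cut-after-c ¬up _) (cut-head up) = ⊥-elim (¬up up)
  cut-unique (cut-after-c _ ¬low) (cut-at-c _ low) = ⊥-elim (¬low low)
  cut-unique (cut-after-c _ _) (cut-after-c _ _) = refl

  cut-bounds : ∀ {Q t h K} → Cut Q t h K → c ≤ K × K ≤ suc k
  cut-bounds (cut-head _) = m≤n⇒m≤1+n c≤k , ≤-refl
  cut-bounds (cut-at-c _ _) = ≤-refl , m≤n⇒m≤1+n c≤k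
  cut-bounds (cut-after-c _ _) = n≤1+n c , s≤s c≤k

  cut-resp : ∀ {Q Q' t h K} → ExIn Q (UpperRival t h) ⇔ ExIn Q' (UpperRival t h) →
    ExIn Q (LowerRival t h) ⇔ ExIn Q' (LowerRival t h) → Cut Q t h K → Cut Q' t h K
  cut-resp up low (cut-head u) = cut-head (Equivalence.to up u)
  cut-resp up low (cut-at-c ¬u l) = cut-at-c (λ u → ¬u (Equivalence.from up u)) (Equivalence.to low l)
  cut-resp up low (cut-after-c ¬u ¬l) =
    cut-after-c (λ u → ¬u (Equivalence.from up u)) (λ l → ¬l (Equivalence.from low l))

  SplicesTo : ℕ → List ℕ → List ℕ → Partition → Set
  SplicesTo K t h τ = ∀ σ ρ → head σ ≡ h → tail ρ ≡ t → τ ≡ splice K σ ρ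

  record Canonical (Q : List Partition) (τ : Partition) : Set where
    constructor canonical
    field
      t h : List ℕ
      K : ℕ
      t-least : IsLeast (LowerTails Q) t
      h-least : IsLeast (UpperHeads Q) h
      cut : Cut Q t h K
      splices : SplicesTo K t h τ

  -- What toggling τ in Q requires: τ is a joinable splice of two other members,
  -- it is not a rival, and whenever it is upper or lower another member with
  -- the same head or tail exists, so no relevant set changes.
  record Toggleable (Q : List Partition) (t h : List ℕ) (τ : Partition) : Set where
    field
      not-upperRival : ¬ UpperRival t h τ
      not-lowerRival : ¬ LowerRival t h τ
      other-lower : ∀ x → Lower τ × tail τ ≡ x → ExIn Q (λ ρ → ρ ≢ τ × (Lower ρ × tail ρ ≡ x))
      other-upper : ∀ x → Upper τ × head τ ≡ x → ExIn Q (λ σ → σ ≢ τ × (Upper σ × head σ ≡ x))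
      spliceOfOthers : SpliceOfOthers Q τ

  -- Cut after the head: τ is the upper rival σ with its rest replaced by that
  -- of t, so τ is upper with head h and differs from σ.
  toggleable-head : ∀ {Q t h σ ρ} → σ ∈ Q → UpperRival t h σ → ρ ∈ Q → Decreasing ρ → Lower ρ →
    tail ρ ≡ t → Toggleable Q t h (splice (suc k) σ ρ)
  toggleable-head {Q} {t} {h} {σ} {ρ} σ∈Q (upσ , headσ , restσ) ρ∈Q decρ lowρ tailρ = record
    { not-upperRival = λ (_ , _ , restτ≢) → restτ≢ restτ
    ; not-lowerRival = λ (lowτ , _) → upper-not-lower upτ lowτ
    ; other-lower = λ _ (lowτ , _) → ⊥-elim (upper-not-lower upτ lowτ)
    ; other-upper = λ x (_ , headτ≡x) → σ , σ∈Q , σ≢τ , upσ , trans headσ (trans (sym headτ) headτ≡x)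
    ; spliceOfOthers = suc k , σ , ρ , σ∈Q , ρ∈Q , σ≢τ , ρ≢τ , refl , joinable }
    where
    τ : Partition
    τ = splice (suc k) σ ρ
    len : suc k ≤ length σ
    len = upper-length upσ
    upτ : Upper τ
    upτ = upper-resp (nth-splice-below (suc k) σ ρ c len (s≤s c≤k)) (nth-splice-below (suc k) σ ρ k len ≤-refl) upσ
    headτ : head τ ≡ h
    headτ = trans (take-splice (suc k) σ ρ len) headσ
    restτ : drop (suc k) τ ≡ rest t
    restτ = trans (drop-splice (suc k) σ ρ len) (trans (drop-head≡rest-tail ρ) (cong rest tailρ))
    σ≢τ : σ ≢ τ
    σ≢τ σ≡τ = restσ (subst (λ z → drop (suc k) z ≡ rest t) (sym σ≡τ) restτ)
    ρ≢τ : ρ ≢ τ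
    ρ≢τ ρ≡τ = upper-not-lower upτ (subst Lower ρ≡τ lowρ)
    joinable : Joinable (suc k) σ ρ
    joinable = <-≤-trans (≤-<-trans (nth-step decρ k) (small-k lowρ)) (large-k upσ)

  -- Cut at c: τ is the lower rival ρ with its first c entries replaced by
  -- those of h, so τ is lower with tail t and differs from ρ.
  toggleable-at-c : ∀ {Q t h σ ρ} → σ ∈ Q → Decreasing σ → Upper σ → head σ ≡ h →
    ρ ∈ Q → LowerRival t h ρ → Toggleable Q t h (splice c σ ρ)
  toggleable-at-c {Q} {t} {h} {σ} {ρ} σ∈Q decσ upσ headσ ρ∈Q (lowρ , tailρ , frontρ) = record
    { not-upperRival = λ (upτ , _) → upper-not-lower upτ lowτ
    ; not-lowerRival = λ (_ , _ , frontτ≢) → frontτ≢ frontτ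
    ; other-lower = λ x (_ , tailτ≡x) → ρ , ρ∈Q , ρ≢τ , lowρ , trans tailρ (trans (sym tailτ) tailτ≡x)
    ; other-upper = λ _ (upτ , _) → ⊥-elim (upper-not-lower upτ lowτ)
    ; spliceOfOthers = c , σ , ρ , σ∈Q , ρ∈Q , σ≢τ , ρ≢τ , refl , joinable }
    where
    τ : Partition
    τ = splice c σ ρ
    len : c ≤ length σ
    len = ≤-trans (m≤n⇒m≤1+n c≤k) (upper-length upσ)
    lowτ : Lower τ
    lowτ = lower-resp (nth-splice-above c σ ρ c len ≤-refl) (nth-splice-above c σ ρ k len c≤k) lowρ
    tailτ : tail τ ≡ t
    tailτ = trans (drop-splice c σ ρ len) tailρ
    frontτ : take c τ ≡ take c h
    frontτ = trans (take-splice c σ ρ len)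
                   (trans (sym (take-take-≤ c (suc k) σ (m≤n⇒m≤1+n c≤k))) (cong (take c) headσ))
    ρ≢τ : ρ ≢ τ
    ρ≢τ ρ≡τ = frontρ (subst (λ z → take c z ≡ take c h) (sym ρ≡τ) frontτ)
    σ≢τ : σ ≢ τ
    σ≢τ σ≡τ = upper-not-lower upσ (subst Lower (sym σ≡τ) lowτ)
    joinable : Joinable c σ ρ
    joinable = joinable-from c σ ρ decσ (≤-<-trans (small-c lowρ) (large-c upσ))

  -- Cut just after c: τ is large at c (from σ) and small at k (from ρ), so it
  -- is neither upper nor lower.
  toggleable-after-c : ∀ {Q t h σ ρ} → σ ∈ Q → Upper σ → ρ ∈ Q → Decreasing ρ → Lower ρ →
    Toggleable Q t h (splice (suc c) σ ρ)
  toggleable-after-c {Q} {t} {h} {σ} {ρ} σ∈Q upσ ρ∈Q decρ lowρ = record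
    { not-upperRival = λ (upτ , _) → ¬upτ upτ
    ; not-lowerRival = λ (lowτ , _) → ¬lowτ lowτ
    ; other-lower = λ _ (lowτ , _) → ⊥-elim (¬lowτ lowτ)
    ; other-upper = λ _ (upτ , _) → ⊥-elim (¬upτ upτ)
    ; spliceOfOthers = suc c , σ , ρ , σ∈Q , ρ∈Q , (λ σ≡τ → ¬upτ (subst Upper σ≡τ upσ)) ,
                       (λ ρ≡τ → ¬lowτ (subst Lower ρ≡τ lowρ)) , refl , joinable }
    where
    τ : Partition
    τ = splice (suc c) σ ρ
    len : suc c ≤ length σ
    len = ≤-trans (s≤s c≤k) (upper-length upσ)
    ¬lowτ : ¬ Lower τ
    ¬lowτ lowτ = <⇒≱ (large-c upσ) (subst (_≤ r) (nth-splice-below (suc c) σ ρ c len ≤-refl) (small-c lowτ))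
    ¬upτ : ¬ Upper τ
    ¬upτ upτ = <⇒≱ (small-k lowρ) (subst (p ≤_) (nth-splice-above (suc c) σ ρ k len c<k) (large-k upτ))
    joinable : Joinable (suc c) σ ρ
    joinable = ≤-<-trans (nth-step decρ c) (≤-<-trans (small-c lowρ) (large-c upσ))

  canonical-toggleable : ∀ {Q τ} → All IsPartition Q → (C : Canonical Q τ) →
    Toggleable Q (Canonical.t C) (Canonical.h C) τ
  canonical-toggleable {Q} parts (canonical t h K ((ρ₀ , ρ₀∈Q , lowρ₀ , tailρ₀) , _)
                                                 ((σ₀ , σ₀∈Q , upσ₀ , headσ₀) , _) cut splices)
    with cut
  ... | cut-head (σ , σ∈Q , rival) =
    subst (Toggleable Q t h) (sym (splices σ ρ₀ (proj₁ (proj₂ rival)) tailρ₀))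
          (toggleable-head σ∈Q rival ρ₀∈Q (member-decreasing parts ρ₀∈Q) lowρ₀ tailρ₀)
  ... | cut-at-c _ (ρ , ρ∈Q , rival) =
    subst (Toggleable Q t h) (sym (splices σ₀ ρ headσ₀ (proj₁ (proj₂ rival))))
          (toggleable-at-c σ₀∈Q (member-decreasing parts σ₀∈Q) upσ₀ headσ₀ ρ∈Q rival)
  ... | cut-after-c _ _ =
    subst (Toggleable Q t h) (sym (splices σ₀ ρ₀ headσ₀ tailρ₀))
          (toggleable-after-c σ₀∈Q upσ₀ ρ₀∈Q (member-decreasing parts ρ₀∈Q) lowρ₀)

  canonical-exists : ∀ Q → ExIn Q Upper → ExIn Q Lower → ∃[ τ ] Canonical Q τ
  canonical-exists Q someUpper someLower
    with least-image lower? tail Q someLower | least-image upper? head Q someUpper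
  ... | t , t-least@((ρ₀ , _ , _ , tailρ₀) , _) | h , h-least@((σ₀ , _ , _ , headσ₀) , _)
    with cut-exists Q t h
  ... | K , cut = splice K σ₀ ρ₀ , canonical t h K t-least h-least cut splices
    where
    splices : SplicesTo K t h (splice K σ₀ ρ₀)
    splices σ ρ headσ tailρ = splice-cong σ₀ σ ρ₀ ρ (proj₁ (cut-bounds cut)) (proj₂ (cut-bounds cut))
                                          (trans headσ₀ (sym headσ)) (trans tailρ₀ (sym tailρ))

  -- The data (t, h, K) are determined by Q, and they determine τ.
  canonical-unique : ∀ {Q τ τ'} → Canonical Q τ → Canonical Q τ' → τ ≡ τ'
  canonical-unique (canonical t h K t-least h-least cut splices) (canonical t' h' K' t-least' h-least' cut' splices')
    with isLeast-unique t-least t-least' | isLeast-unique h-least h-least'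
  ... | refl | refl with cut-unique cut cut'
  ... | refl with t-least | h-least
  ... | (ρ₀ , _ , _ , tailρ₀) , _ | (σ₀ , _ , _ , headσ₀) , _ =
    trans (splices σ₀ ρ₀ headσ₀ tailρ₀) (sym (splices' σ₀ ρ₀ headσ₀ tailρ₀))

  canonical-setEq : ∀ {Q Q' τ} → SetEq Q Q' → Canonical Q τ → Canonical Q' τ
  canonical-setEq Q≈Q' (canonical t h K t-least h-least cut splices) =
    canonical t h K (isLeast-resp (λ _ → exIn-setEq Q≈Q') t-least) (isLeast-resp (λ _ → exIn-setEq Q≈Q') h-least)
                    (cut-resp (exIn-setEq Q≈Q') (exIn-setEq Q≈Q') cut) splices

  -- Toggling τ(Q) changes none of the sets defining (t, h, K).
  canonical-toggle : ∀ {Q τ} → All IsPartition Q → Canonical Q τ → Canonical (toggle τ Q) τ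
  canonical-toggle parts C@(canonical t h K t-least h-least cut splices) =
    canonical t h K (isLeast-resp (λ x → exIn-toggle (other-lower x)) t-least)
                    (isLeast-resp (λ x → exIn-toggle (other-upper x)) h-least)
                    (cut-resp (exIn-toggle (λ rival → ⊥-elim (not-upperRival rival)))
                              (exIn-toggle (λ rival → ⊥-elim (not-lowerRival rival))) cut)
                    splices
    where open Toggleable (canonical-toggleable parts C)

  signedSum-vanishes : ∀ P₀ → (∀ Q → InClassOf P₀ Q → ExIn Q Upper × ExIn Q Lower) →
    ∀ L → EnumeratesClass P₀ L → signedSum L ≡ 0ℤ
  signedSum-vanishes P₀ upper-and-lower = SignReversingInvolution.signedSum-vanishes Canonical
    (λ Q inClass → canonical-exists Q (proj₁ (upper-and-lower Q inClass)) (proj₂ (upper-and-lower Q inClass)))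
    canonical-unique canonical-setEq
    (λ inClass → canonical-toggle (parts inClass))
    (λ inClass C → Toggleable.spliceOfOthers (canonical-toggleable (parts inClass) C))
    where
    parts : ∀ {Q} → InClassOf P₀ Q → All IsPartition Q
    parts inClass = proj₁ (proj₁ inClass)

profile-witness : ∀ {P₀ Q v a b} → InClassOf P₀ Q → InProfile P₀ v a b →
  ∃[ σ ] (σ ∈ Q × IsPInterval σ v a b)
profile-witness (_ , _ , same) inP = proj₁ (Equivalence.from (same _ _ _) inP)

vanishes-from-witnesses : ∀ {P₀ c₀ k r p v a b w a' b'} (c₀<k : c₀ < k) (1≤p : 1 ≤ p) →
  InProfile P₀ v a b → InProfile P₀ w a' b' →
  (∀ {σ} → Decreasing σ → IsPInterval σ v a b → CanonicalSplice.Upper c₀ k r p c₀<k 1≤p σ) →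
  (∀ {ρ} → Decreasing ρ → IsPInterval ρ w a' b' → CanonicalSplice.Lower c₀ k r p c₀<k 1≤p ρ) →
  ∀ L → EnumeratesClass P₀ L → signedSum L ≡ 0ℤ
vanishes-from-witnesses {P₀} {c₀} {k} {r} {p} c₀<k 1≤p inV inW to-upper to-lower =
  signedSum-vanishes P₀ upper-and-lower
  where
  open CanonicalSplice c₀ k r p c₀<k 1≤p
  upper-and-lower : ∀ Q → InClassOf P₀ Q → ExIn Q Upper × ExIn Q Lower
  upper-and-lower Q inClass with profile-witness inClass inV | profile-witness inClass inW
  ... | σ , σ∈Q , I | ρ , ρ∈Q , J =
    (σ , σ∈Q , to-upper (member-decreasing parts σ∈Q) I) , (ρ , ρ∈Q , to-lower (member-decreasing parts ρ∈Q) J)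
    where
    parts : All IsPartition Q
    parts = proj₁ (proj₁ inClass)

-- Distinct values q < p with c < b: cut between the start c₀ of the
-- q-interval and the end k of the p-interval.  Realisations of (p, [a, b])
-- are then upper and those of (q, [c, d]) lower, for the threshold r = q.
vanishes-distinct-values : ∀ {P₀ p q a b c d} → InProfile P₀ p a b → InProfile P₀ q c d → q < p → c <ᵉ b →
  ∀ L → EnumeratesClass P₀ L → signedSum L ≡ 0ℤ
vanishes-distinct-values {p = p} {q} {b = b} inP@((_ , _ , I) , _) inQ@((_ , _ , J) , _) q<p c<b
  with finite-position (PInterval.Idx-end I) (λ b≡∞ → <⇒≱ q<p (≤-trans (≤-reflexive (PInterval.end-∞ I b≡∞)) z≤n))
     | PInterval.start-fin J
... | k , refl | c₀ , refl with c<b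
... | fin<fin (s≤s c₀<k) = vanishes-from-witnesses c₀<k 1≤p inP inQ to-upper to-lower
  where
  1≤p : 1 ≤ p
  1≤p = ≤-<-trans z≤n q<p
  open CanonicalSplice c₀ k q p c₀<k 1≤p
  to-upper : ∀ {σ a} → Decreasing σ → IsPInterval σ p a (fin (suc k)) → Upper σ
  to-upper dec I = upper (<-≤-trans q<p (subst (_≤ _) (PInterval.value-end I) (nth-mono dec (<⇒≤ c₀<k))))
                         (≤-reflexive (sym (PInterval.value-end I)))
  to-lower : ∀ {ρ d} → Decreasing ρ → IsPInterval ρ q (fin (suc c₀)) d → Lower ρ
  to-lower dec J = lower (≤-reflexive (PInterval.value-start J))
                         (≤-<-trans (subst (_ ≤_) (PInterval.value-start J) (nth-mono dec (<⇒≤ c₀<k))) q<p)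

profile-nested : ∀ {P v a b c d} → InProfile P v a b → InProfile P v c d → (a , b) ⊆ᴵ (c , d) →
  a ≡ c × b ≡ d
profile-nested ((_ , _ , I) , maximal) ((ρ , ρ∈P , J) , _) ⊆ =
  ⊆ᴵ-antisym (PInterval.Idx-start I) (PInterval.start≤end I) (PInterval.Idx-start J) (PInterval.start≤end J)
             ⊆ (maximal ρ _ _ ρ∈P J ⊆)

profile-shifted : ∀ {P v a b c d} → InProfile P v a b → InProfile P v c d → ¬ (a ≡ c × b ≡ d) →
  (c <ᵉ a × d <ᵉ b) ⊎ (a <ᵉ c × b <ᵉ d)
profile-shifted {a = a} {b} {c} {d} inA inC distinct with <ᵉ-or-≥ᵉ c a
... | inj₁ c<a with <ᵉ-or-≥ᵉ d b
...   | inj₁ d<b = inj₁ (c<a , d<b)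
...   | inj₂ b≤d = ⊥-elim (distinct (profile-nested inA inC (⊆ᴵ-from-endpoints (<ᵉ⇒≤ᵉ c<a) b≤d)))
profile-shifted {a = a} {b} {c} {d} inA inC distinct | inj₂ a≤c with <ᵉ-or-≥ᵉ b d
... | inj₂ d≤b = ⊥-elim (distinct (map× sym sym (profile-nested inC inA (⊆ᴵ-from-endpoints a≤c d≤b))))
... | inj₁ b<d with <ᵉ-or-≥ᵉ a c
...   | inj₁ a<c = inj₂ (a<c , b<d)
...   | inj₂ c≤a = ⊥-elim (distinct (profile-nested inA inC (⊆ᴵ-from-endpoints c≤a (<ᵉ⇒≤ᵉ b<d))))

-- Equal values, the interval [γ, δ] strictly left of [α, β]: cut between the
-- start c₀ of [γ, δ] and the end k of [α, β], with threshold r = p.  A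
-- realisation of [α, β] exceeds p at c₀ (which lies before α), one of [γ, δ]
-- falls below p at k (which lies after δ).
vanishes-shifted : ∀ {P₀ p α β γ δ} → InProfile P₀ p α β → InProfile P₀ p γ δ → γ <ᵉ α → δ <ᵉ β →
  ∀ L → EnumeratesClass P₀ L → signedSum L ≡ 0ℤ
vanishes-shifted {p = p} inA@((_ , _ , I) , _) inC@((_ , _ , J) , _) γ<α δ<β
  with PInterval.start-fin I | PInterval.start-fin J | finite-position (PInterval.Idx-end J) (<ᵉ⇒≢∞ δ<β)
... | a₀ , refl | c₀ , refl | d₀ , refl
  with PInterval.end-fin J refl
... | 1≤p
  with finite-position (PInterval.Idx-end I) (λ β≡∞ → <⇒≱ 1≤p (≤-reflexive (PInterval.end-∞ I β≡∞)))
... | k , refl with γ<α | PInterval.start≤end I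
... | fin<fin (s≤s c₀<a₀) | fin≤fin (s≤s a₀≤k) = vanishes-from-witnesses c₀<k 1≤p inA inC to-upper to-lower
  where
  c₀<k : c₀ < k
  c₀<k = <-≤-trans c₀<a₀ a₀≤k
  open CanonicalSplice c₀ k p p c₀<k 1≤p
  to-upper : ∀ {σ} → Decreasing σ → IsPInterval σ p (fin (suc a₀)) (fin (suc k)) → Upper σ
  to-upper dec I = upper
    (≤∧≢⇒< (subst (_≤ _) (value-start) (nth-mono dec (<⇒≤ c₀<a₀)))
           (λ p≡σc₀ → value-outside (fin≤fin (s≤s z≤n)) (λ (α≤ , _) → <ᵉ⇒≱ᵉ γ<α α≤) (sym p≡σc₀)))
    (≤-reflexive (sym value-end))
    where open PInterval I
  to-lower : ∀ {ρ} → Decreasing ρ → IsPInterval ρ p (fin (suc c₀)) (fin (suc d₀)) → Lower ρ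
  to-lower dec J = lower
    (≤-reflexive value-start)
    (≤∧≢⇒< (subst (_ ≤_) value-start (nth-mono dec (<⇒≤ c₀<k)))
           (value-outside (fin≤fin (s≤s z≤n)) (λ (_ , ≤δ) → <ᵉ⇒≱ᵉ δ<β ≤δ)))
    where open PInterval J

-- Lemma 4.12.  For q < p the values differ and c < b places the cut; for
-- q = p the two distinct maximal intervals are strictly shifted.
lemma4p12 : (P₀ : List Partition) → IsFinSetPart P₀ → NonEmpty P₀ →
    (p q : ℕ) (a b c d : Ext) →
    InProfile P₀ p a b → InProfile P₀ q c d →
    ¬ (p ≡ q × a ≡ c × b ≡ d) →
    q ≤ p → c <ᵉ b →
    (L : List (List Partition)) → EnumeratesClass P₀ L →
    signedSum L ≡ 0ℤ
lemma4p12 P₀ _ _ p q a b c d inP inQ distinct q≤p c<b with m≤n⇒m<n∨m≡n q≤p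
... | inj₁ q<p = vanishes-distinct-values inP inQ q<p c<b
... | inj₂ refl with profile-shifted inP inQ (λ (a≡c , b≡d) → distinct (refl , a≡c , b≡d))
...   | inj₁ (c<a , d<b) = vanishes-shifted inP inQ c<a d<b
...   | inj₂ (a<c , b<d) = vanishes-shifted inQ inP a<c b<d
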